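{- Let $P$ be a finite $\Gamma$-colored $d$-complete poset with top tree $T$ and assume $\Gamma$ is simply laced. Then the restriction $\tilde\kappa:=\kappa|_T$ is a graph isomorphism from $Gr(T)$ to $\Gamma$ (viewed as the simple graph with edges between adjacent colors).
   Context: Dynkin diagram $\Gamma$: finite set with integers $\theta_{ab}$, $\theta_{aa}=2$, $\theta_{ab}\le0$ ($a\ne b$), $\theta_{ab}=0\iff\theta_{ba}=0$; $a\sim b$ if $a\ne b$ and $\theta_{ab}<0$; simply laced: all $\theta_{ab}\in\{ -1,0,2\}$. $\Gamma$-colored poset: poset with surjective $\kappa:P\to\Gamma$. Consecutive elements of color $a$: $x<y$ of color $a$, no color-$a$ element in $(x,y)$. $U(x,P)=\{y>x:\kappa(y)\sim\kappa(x)\}$. $\Gamma$-colored $d$-complete: locally finite with (EC) equal colors comparable; (NA) neighbors (one covers the other) have adjacent colors; (AC) adjacent colors comparable; (ICE2) consecutive $x<y$ of color $a$ have $\sum_{z\in(x,y)}-\theta_{\kappa(z),a}=2$; (UCB1) for maximal $x$ of color $a$, $U(x,P)$ finite and $\sum_{y\in U(x,P)}-\theta_{\kappa(y),a}\le1$. The top tree $T$ of finite $P$ is the set of elements maximal among elements of their color. $Gr(T)$ is the simple graph with vertex set $T$ and an edge between $x,y$ iff one covers the other in $T$. -}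

module Defs where

open import Data.Nat using (ℕ)
open import Data.Fin using (Fin)
open import Data.Fin.Properties using (_≟_)
open import Data.Integer using (ℤ; +_; -_; _<_; _≤_; -[1+_])
open import Data.List using (List; filter; foldr; map)
open import Data.List using () renaming (_∷_ to _∷ₗ_)
open import Data.Fin.Base using () renaming (_≤_ to _≤ꟳ_)
open import Data.Vec.Functional using ()
open import Data.List.Base using ()
open import Data.Product using (Σ; _×_; _,_; ∃; ∃-syntax; proj₁)
open import Data.Sum using (_⊎_)
open import Relation.Binary using (Rel; IsDecPartialOrder)
open import Relation.Binary.PropositionalEquality using (_≡_; _≢_)
open import Relation.Nullary using (¬_; Dec; yes; no)
open import Relation.Nullary.Decidable using (_×-dec_; ¬?)
open import Relation.Unary using (Decidable)
open import Function.Bundles using (_⇔_)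
import Data.Integer as ℤ

record DynkinDiagram (m : ℕ) : Set where
  field
    θ       : Fin m → Fin m → ℤ
    diag    : ∀ a → θ a a ≡ + 2
    offdiag : ∀ a b → a ≢ b → θ a b ≤ + 0
    zeroSym : ∀ a b → θ a b ≡ + 0 → θ b a ≡ + 0

Adjacent : ∀ {m} → DynkinDiagram m → Fin m → Fin m → Set
Adjacent Γ a b = a ≢ b × DynkinDiagram.θ Γ a b < + 0

SimplyLaced : ∀ {m} → DynkinDiagram m → Set
SimplyLaced Γ = ∀ a b → (θ a b ≡ -[1+ 0 ]) ⊎ (θ a b ≡ + 0) ⊎ (θ a b ≡ + 2)
  where open DynkinDiagram Γ

sumℤ : List ℤ → ℤ
sumℤ = foldr ℤ._+_ (+ 0)

allFinList : ∀ n → List (Fin n)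
allFinList n = Data.List.allFin n

sumOver : ∀ {n} {P : Fin n → Set} → Decidable P → (Fin n → ℤ) → ℤ
sumOver {n} P? f = sumℤ (map f (filter P? (allFinList n)))

record ColoredPoset {m : ℕ} (Γ : DynkinDiagram m) (n : ℕ) : Set₁ where
  field
    _⊑_        : Rel (Fin n) _
    isDecPO    : IsDecPartialOrder _≡_ _⊑_
    κ          : Fin n → Fin m
    surjective : ∀ a → ∃[ x ] κ x ≡ a

  open DynkinDiagram Γ public
  open IsDecPartialOrder isDecPO public using () renaming (_≤?_ to _⊑?_)

  _⊏_ : Fin n → Fin n → Set
  x ⊏ y = x ⊑ y × x ≢ y

  _⊏?_ : ∀ x y → Dec (x ⊏ y)
  x ⊏? y = (x ⊑? y) ×-dec ¬? (x ≟ y)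

  Comparable : Fin n → Fin n → Set
  Comparable x y = x ⊑ y ⊎ y ⊑ x

  Covers : Fin n → Fin n → Set
  Covers y x = x ⊏ y × ¬ (∃[ z ] (x ⊏ z × z ⊏ y))

  Neighbors : Fin n → Fin n → Set
  Neighbors x y = Covers x y ⊎ Covers y x

  _∼_ : Fin m → Fin m → Set
  a ∼ b = Adjacent Γ a b

  Consecutive : Fin m → Fin n → Fin n → Set
  Consecutive a x y =
    κ x ≡ a × κ y ≡ a × x ⊏ y × ¬ (∃[ z ] (x ⊏ z × z ⊏ y × κ z ≡ a))

  intervalSum : Fin m → Fin n → Fin n → ℤ
  intervalSum a x y = sumOver (λ z → (x ⊏? z) ×-dec (z ⊏? y)) (λ z → - θ (κ z) a)

  MaximalInColor : Fin n → Set
  MaximalInColor x = ¬ (∃[ y ] (x ⊏ y × κ y ≡ κ x))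

  _∼?_ : ∀ a b → Dec (a ∼ b)
  a ∼? b = ¬? (a ≟ b) ×-dec (θ a b ℤ.<? + 0)

  upperSum : Fin n → ℤ
  upperSum x = sumOver (λ y → (x ⊏? y) ×-dec (κ y ∼? κ x)) (λ y → - θ (κ y) (κ x))

-- Γ-colored d-complete (P is finite, hence locally finite and every U(x,P) finite)
record IsDComplete {m : ℕ} {Γ : DynkinDiagram m} {n : ℕ} (P : ColoredPoset Γ n) : Set where
  open ColoredPoset P
  field
    EC   : ∀ x y → κ x ≡ κ y → Comparable x y
    NA   : ∀ x y → Neighbors x y → κ x ∼ κ y
    AC   : ∀ x y → κ x ∼ κ y → Comparable x y
    ICE2 : ∀ a x y → Consecutive a x y → intervalSum a x y ≡ + 2
    UCB1 : ∀ x → MaximalInColor x → upperSum x ≤ + 1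

module _ {m : ℕ} {Γ : DynkinDiagram m} {n : ℕ} (P : ColoredPoset Γ n) where
  open ColoredPoset P

  InTopTree : Fin n → Set
  InTopTree = MaximalInColor

  TopTree : Set
  TopTree = Σ (Fin n) InTopTree

  CoversInT : TopTree → TopTree → Set
  CoversInT (y , _) (x , _) =
    x ⊏ y × ¬ (∃[ z ] (InTopTree z × x ⊏ z × z ⊏ y))

  GrEdge : TopTree → TopTree → Set
  GrEdge s t = CoversInT s t ⊎ CoversInT t s

  κ̃ : TopTree → Fin m
  κ̃ t = κ (proj₁ t)

  IsGraphIso : Set
  IsGraphIso =
    (∀ s t → κ̃ s ≡ κ̃ t → proj₁ s ≡ proj₁ t)
    × (∀ a → ∃[ t ] κ̃ t ≡ a)
    × (∀ s t → GrEdge s t ⇔ (κ̃ s ∼ κ̃ t))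

module Submission where

-- If x is maximal in its color, every cover y of x has a color adjacent to κ x (NA), so
-- y ∈ U(x,P). Each element of U(x,P) contributes at least 1 to the sum that (UCB1) bounds
-- by 1, so U(x,P) has at most one element. Hence covers of
-- top-tree elements lie in the top tree, covers within T are covers in P, and of two
-- top-tree elements of adjacent colors, comparable by (AC), the larger covers the smaller.
-- Injectivity of κ on T is (EC); surjectivity holds because P is finite.

open import Defs
open import Data.Nat using (ℕ; z≤n; s≤s)
open import Data.Fin using (Fin)
open import Data.Fin.Properties using (_≟_; any?)
open import Data.Fin.Induction using (po-wellFounded; po-noetherian)
open import Data.Integer as ℤ using (ℤ; +_; -_; +≤+)
import Data.Integer.Properties as ℤ
open import Data.List using (List; []; _∷_; filter; map)
open import Data.List.Membership.Propositional using (_∈_)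
open import Data.List.Membership.Propositional.Properties using (∈-allFin)
open import Data.List.Relation.Unary.Any using (here; there)
open import Data.Product using (_×_; _,_; ∃-syntax; proj₁; proj₂)
import Data.Sum as Sum
open import Data.Sum using (inj₁; inj₂)
open import Data.Empty using (⊥-elim)
open import Relation.Binary using (IsDecPartialOrder)
import Relation.Binary.Construct.NonStrictToStrict as ToStrict
open import Relation.Binary.PropositionalEquality using (_≡_; _≢_; refl; sym; trans; cong; subst)
open import Relation.Nullary using (¬_; yes; no)
open import Relation.Nullary.Decidable using (_×-dec_)
open import Relation.Unary using (Decidable)
open import Function.Bundles using (_⇔_; mk⇔)
open import Function.Construct.Composition using (_⇔-∘_)
open import Induction.WellFounded using (Acc; acc)

0≤j⇒i≤j+i : ∀ {i j} → + 0 ℤ.≤ j → i ℤ.≤ j ℤ.+ i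
0≤j⇒i≤j+i {i} 0≤j = ℤ.≤-trans (ℤ.≤-reflexive (sym (ℤ.+-identityˡ i))) (ℤ.+-monoˡ-≤ i 0≤j)

0≤j⇒i≤i+j : ∀ {i j} → + 0 ℤ.≤ j → i ℤ.≤ i ℤ.+ j
0≤j⇒i≤i+j {i} {j} 0≤j = subst (i ℤ.≤_) (ℤ.+-comm j i) (0≤j⇒i≤j+i 0≤j)

¬2≤1 : ¬ (+ 2 ℤ.≤ + 1)
¬2≤1 (+≤+ (s≤s ()))

module FilteredSum {A : Set} {Q : A → Set} (Q? : Decidable Q) (f : A → ℤ)
                   (f-nonneg : ∀ x → Q x → + 0 ℤ.≤ f x) where

  Σ[_] : List A → ℤ
  Σ[ xs ] = sumℤ (map f (filter Q? xs))

  Σ-nonneg : ∀ xs → + 0 ℤ.≤ Σ[ xs ]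
  Σ-nonneg []       = ℤ.≤-refl
  Σ-nonneg (x ∷ xs) with Q? x
  ... | yes q = ℤ.≤-trans (Σ-nonneg xs) (0≤j⇒i≤j+i (f-nonneg x q))
  ... | no _  = Σ-nonneg xs

  term≤Σ : ∀ {y xs} → y ∈ xs → Q y → f y ℤ.≤ Σ[ xs ]
  term≤Σ {xs = x ∷ xs} (here refl) qy with Q? x
  ... | yes _  = 0≤j⇒i≤i+j (Σ-nonneg xs)
  ... | no ¬qy = ⊥-elim (¬qy qy)
  term≤Σ {xs = x ∷ xs} (there y∈xs) qy with Q? x
  ... | yes q = ℤ.≤-trans (term≤Σ y∈xs qy) (0≤j⇒i≤j+i (f-nonneg x q))
  ... | no _  = term≤Σ y∈xs qy

  pair≤Σ : ∀ {y z xs} → y ∈ xs → z ∈ xs → y ≢ z → Q y → Q z → f y ℤ.+ f z ℤ.≤ Σ[ xs ]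
  pair≤Σ (here refl) (here refl) y≢z _ _ = ⊥-elim (y≢z refl)
  pair≤Σ {xs = x ∷ xs} (here refl) (there z∈xs) _ qy qz with Q? x
  ... | yes _  = ℤ.+-monoʳ-≤ (f x) (term≤Σ z∈xs qz)
  ... | no ¬qy = ⊥-elim (¬qy qy)
  pair≤Σ {y} {xs = x ∷ xs} (there y∈xs) (here refl) _ qy qz with Q? x
  ... | yes _  = ℤ.≤-trans (ℤ.≤-reflexive (ℤ.+-comm (f y) (f x))) (ℤ.+-monoʳ-≤ (f x) (term≤Σ y∈xs qy))
  ... | no ¬qz = ⊥-elim (¬qz qz)
  pair≤Σ {xs = x ∷ xs} (there y∈xs) (there z∈xs) y≢z qy qz with Q? x
  ... | yes q = ℤ.≤-trans (pair≤Σ y∈xs z∈xs y≢z qy qz) (0≤j⇒i≤j+i (f-nonneg x q))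
  ... | no _  = pair≤Σ y∈xs z∈xs y≢z qy qz

module _ {m : ℕ} (Γ : DynkinDiagram m) where
  open DynkinDiagram Γ

  Adjacent-sym : ∀ {a b} → Adjacent Γ a b → Adjacent Γ b a
  Adjacent-sym {a} {b} (a≢b , θab<0) = b≢a , ℤ.≤∧≢⇒< (offdiag b a b≢a) θba≢0
    where
    b≢a : b ≢ a
    b≢a b≡a = a≢b (sym b≡a)
    θba≢0 : θ b a ≢ + 0
    θba≢0 θba≡0 = ℤ.<-irrefl (zeroSym b a θba≡0) θab<0

  Adjacent⇒1≤-θ : ∀ {a b} → Adjacent Γ a b → + 1 ℤ.≤ - θ a b
  Adjacent⇒1≤-θ (_ , θab<0) = ℤ.i<j⇒suc[i]≤j (ℤ.neg-mono-< θab<0)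

module ColoredPosetProperties {m : ℕ} {Γ : DynkinDiagram m} {n : ℕ} (P : ColoredPoset Γ n) where
  open ColoredPoset P
  private module PO = IsDecPartialOrder isDecPO

  ⊏-trans : ∀ {x y z} → x ⊏ y → y ⊏ z → x ⊏ z
  ⊏-trans = ToStrict.<-trans _≡_ _⊑_ PO.isPartialOrder

  ⊑-⊏-trans : ∀ {x y z} → x ⊑ y → y ⊏ z → x ⊏ z
  ⊑-⊏-trans = ToStrict.≤-<-trans _≡_ _⊑_ PO.trans PO.antisym (λ { refl x⊑y → x⊑y })

  ⊏⇒⋢ : ∀ {x y} → x ⊏ y → ¬ (y ⊑ x)
  ⊏⇒⋢ = ToStrict.<⇒≱ _≡_ _⊑_ PO.antisym

  ∃-cover-below : ∀ {x z} → x ⊏ z → ∃[ y ] (Covers y x × y ⊑ z)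
  ∃-cover-below {x} {z} x⊏z = go z (po-wellFounded PO.isPartialOrder z) x⊏z
    where
    go : ∀ z → Acc _⊏_ z → x ⊏ z → ∃[ y ] (Covers y x × y ⊑ z)
    go z (acc rec) x⊏z with any? (λ w → (x ⊏? w) ×-dec (w ⊏? z))
    ... | no nothing-between = z , (x⊏z , nothing-between) , PO.refl
    ... | yes (w , x⊏w , w⊏z) with go w (rec w⊏z) x⊏w
    ... | y , y-covers-x , y⊑w = y , y-covers-x , PO.trans y⊑w (proj₁ w⊏z)

  ∃-maximal-of-color : ∀ x → ∃[ t ] (MaximalInColor t × κ t ≡ κ x)
  ∃-maximal-of-color x = go x (po-noetherian PO.isPartialOrder x)
    where
    go : ∀ y → Acc (λ u v → v ⊏ u) y → ∃[ t ] (MaximalInColor t × κ t ≡ κ y)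
    go y (acc rec) with any? (λ u → (y ⊏? u) ×-dec (κ u ≟ κ y))
    ... | no y-maximal = y , y-maximal , refl
    ... | yes (u , y⊏u , κu≡κy) with go u (rec y⊏u)
    ... | t , t-maximal , κt≡κu = t , t-maximal , trans κt≡κu κu≡κy

  Covers⇒CoversInT : ∀ (s t : TopTree P) → Covers (proj₁ s) (proj₁ t) → CoversInT P s t
  Covers⇒CoversInT _ _ (t⊏s , nothing-between) =
    t⊏s , λ { (z , _ , t⊏z , z⊏s) → nothing-between (z , t⊏z , z⊏s) }

module DCompleteProperties {m : ℕ} {Γ : DynkinDiagram m} {n : ℕ} {P : ColoredPoset Γ n}
                           (D : IsDComplete P) where
  open ColoredPoset P
  open IsDComplete D
  open ColoredPosetProperties P

  upper-subsingleton : ∀ {x y z} → MaximalInColor x →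
                       x ⊏ y → κ y ∼ κ x → x ⊏ z → κ z ∼ κ x → y ≡ z
  upper-subsingleton {x} {y} {z} x-maximal x⊏y κy∼κx x⊏z κz∼κx with y ≟ z
  ... | yes y≡z = y≡z
  ... | no y≢z  = ⊥-elim (¬2≤1 (ℤ.≤-trans 2≤upperSum (UCB1 x x-maximal)))
    where
    open FilteredSum (λ u → (x ⊏? u) ×-dec (κ u ∼? κ x)) (λ u → - θ (κ u) (κ x))
                     (λ u q → ℤ.≤-trans (+≤+ z≤n) (Adjacent⇒1≤-θ Γ (proj₂ q)))
    2≤upperSum : + 2 ℤ.≤ upperSum x
    2≤upperSum = ℤ.≤-trans (ℤ.+-mono-≤ (Adjacent⇒1≤-θ Γ κy∼κx) (Adjacent⇒1≤-θ Γ κz∼κx))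
                           (pair≤Σ (∈-allFin y) (∈-allFin z) y≢z (x⊏y , κy∼κx) (x⊏z , κz∼κx))

  cover-of-maximal-is-maximal : ∀ {x y} → MaximalInColor x → Covers y x → MaximalInColor y
  cover-of-maximal-is-maximal {x} x-maximal y-covers-x@(x⊏y , _) (y' , y⊏y' , κy'≡κy) =
    proj₂ y⊏y' (upper-subsingleton x-maximal x⊏y κy∼κx (⊏-trans x⊏y y⊏y')
                                    (subst (_∼ κ x) (sym κy'≡κy) κy∼κx))
    where κy∼κx = NA _ x (inj₁ y-covers-x)

  adjacent-above-maximal-covers : ∀ {x u} → MaximalInColor x → x ⊏ u → κ u ∼ κ x → Covers u x
  adjacent-above-maximal-covers {x} {u} x-maximal x⊏u κu∼κx = x⊏u , nothing-between
    where
    nothing-between : ¬ (∃[ z ] (x ⊏ z × z ⊏ u))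
    nothing-between (z , x⊏z , z⊏u) with ∃-cover-below x⊏z
    ... | y , y-covers-x@(x⊏y , _) , y⊑z =
      ⊏⇒⋢ z⊏u (subst (_⊑ z) (upper-subsingleton x-maximal x⊏y (NA y x (inj₁ y-covers-x)) x⊏u κu∼κx) y⊑z)

  CoversInT⇒Covers : ∀ (s t : TopTree P) → CoversInT P s t → Covers (proj₁ s) (proj₁ t)
  CoversInT⇒Covers s (t , t-maximal) (t⊏s , nothing-between-in-T) = t⊏s , nothing-between
    where
    nothing-between : ¬ (∃[ z ] (t ⊏ z × z ⊏ proj₁ s))
    nothing-between (z , t⊏z , z⊏s) with ∃-cover-below t⊏z
    ... | y , y-covers-t , y⊑z =
      nothing-between-in-T (y , cover-of-maximal-is-maximal t-maximal y-covers-t ,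
                            proj₁ y-covers-t , ⊑-⊏-trans y⊑z z⊏s)

  GrEdge⇔Neighbors : ∀ (s t : TopTree P) → GrEdge P s t ⇔ Neighbors (proj₁ s) (proj₁ t)
  GrEdge⇔Neighbors s t =
    mk⇔ (Sum.map (CoversInT⇒Covers s t) (CoversInT⇒Covers t s))
        (Sum.map (Covers⇒CoversInT s t) (Covers⇒CoversInT t s))

  Neighbors⇔adjacent : ∀ (s t : TopTree P) → Neighbors (proj₁ s) (proj₁ t) ⇔ (κ̃ P s ∼ κ̃ P t)
  Neighbors⇔adjacent (s , s-maximal) (t , t-maximal) = mk⇔ (NA s t) from
    where
    from : κ s ∼ κ t → Neighbors s t
    from κs∼κt with AC s t κs∼κt
    ... | inj₁ s⊑t = inj₂ (adjacent-above-maximal-covers s-maximal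
                             (s⊑t , λ s≡t → proj₁ κs∼κt (cong κ s≡t)) (Adjacent-sym Γ κs∼κt))
    ... | inj₂ t⊑s = inj₁ (adjacent-above-maximal-covers t-maximal
                             (t⊑s , λ t≡s → proj₁ κs∼κt (cong κ (sym t≡s))) κs∼κt)

  κ̃-injective : ∀ (s t : TopTree P) → κ̃ P s ≡ κ̃ P t → proj₁ s ≡ proj₁ t
  κ̃-injective (s , s-maximal) (t , t-maximal) κs≡κt with s ≟ t
  ... | yes s≡t = s≡t
  ... | no s≢t with EC s t κs≡κt
  ... | inj₁ s⊑t = ⊥-elim (s-maximal (t , (s⊑t , s≢t) , sym κs≡κt))
  ... | inj₂ t⊑s = ⊥-elim (t-maximal (s , (t⊑s , λ t≡s → s≢t (sym t≡s)) , κs≡κt))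

  κ̃-surjective : ∀ a → ∃[ t ] κ̃ P t ≡ a
  κ̃-surjective a with surjective a
  ... | x , κx≡a with ∃-maximal-of-color x
  ... | t , t-maximal , κt≡κx = (t , t-maximal) , trans κt≡κx κx≡a

proposition4p3 : {m : ℕ} (Γ : DynkinDiagram m) → SimplyLaced Γ →
    {n : ℕ} (P : ColoredPoset Γ n) → IsDComplete P → IsGraphIso P
proposition4p3 Γ _ P D =
  κ̃-injective , κ̃-surjective , λ s t → Neighbors⇔adjacent s t ⇔-∘ GrEdge⇔Neighbors s t
  where open DCompleteProperties D
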